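{- Let $k,t$ be positive integers and let $n\geq 3tk+3t-5$. Then $r(K_{1,n-1},tB_k)=2n+t-2$.
   Context: For graphs $G,H$, the Ramsey number $r(G,H)$ is the smallest positive integer $N$ such that every red-blue coloring of the edges of the complete graph $K_N$ contains a red subgraph isomorphic to $G$ or a blue subgraph isomorphic to $H$. $K_{1,n-1}$ is the star with $n$ vertices. The book $B_k$ is the graph $K_2+\overline{K}_k$ on $k+2$ vertices (an edge together with $k$ further vertices each adjacent to both endpoints of the edge), and $tB_k$ denotes the disjoint union of $t$ vertex-disjoint copies of $B_k$. -}

module Defs where

open import Data.Nat using (ℕ; suc; _+_; _<_; _≤_)
open import Data.Fin using (Fin; toℕ)
open import Data.Product using (Σ; _×_; ∃)
open import Data.Sum using (_⊎_)
open import Relation.Binary.PropositionalEquality using (_≡_; _≢_)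
open import Relation.Nullary using (¬_)
open import Function.Definitions using (Injective)

record Graph : Set₁ where
  field
    V   : Set
    Adj : V → V → Set
open Graph public

data Colour : Set where
  red blue : Colour

-- A red/blue colouring of the edges of K_N (vertex set Fin N):
-- the colour of edge {i,j} (i ≢ j) is col i j = col j i.
record Colouring (N : ℕ) : Set where
  field
    col : Fin N → Fin N → Colour
    sym : ∀ i j → col i j ≡ col j i
open Colouring public

HasMonoCopy : ∀ {N} → Graph → Colour → Colouring N → Set
HasMonoCopy {N} G χ c =
  Σ (V G → Fin N) λ f → Injective _≡_ _≡_ f × (∀ u v → Adj G u v → col c (f u) (f v) ≡ χ)

Arrows : ℕ → Graph → Graph → Set
Arrows N G H = (c : Colouring N) → HasMonoCopy G red c ⊎ HasMonoCopy H blue c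

IsRamseyNumber : Graph → Graph → ℕ → Set
IsRamseyNumber G H R =
  1 ≤ R × Arrows R G H × (∀ N → 1 ≤ N → N < R → ¬ Arrows N G H)

Star : ℕ → Graph
Star n = record
  { V = Fin n
  ; Adj = λ u v → (toℕ u ≡ 0 × toℕ v ≢ 0) ⊎ (toℕ v ≡ 0 × toℕ u ≢ 0) }

Book : ℕ → Graph
Book k = record
  { V = Fin (k + 2)
  ; Adj = λ u v → u ≢ v × (toℕ u < 2 ⊎ toℕ v < 2) }

Copies : ℕ → Graph → Graph
Copies t G = record
  { V = Fin t × V G
  ; Adj = λ p q → Data.Product.proj₁ p ≡ Data.Product.proj₁ q
                  × Adj G (Data.Product.proj₂ p) (Data.Product.proj₂ q) }

module Submission where

-- Upper bound: in a colouring of K_N, N = 2n + t − 2, without a red K_{1,n−1} every blue degree is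
-- at least D = n + t − 1, so 2D = N + t.  Grow a family of disjoint blue triangles: if the
-- uncovered vertices span a triangle, add it; otherwise the two ends of an uncovered edge have no
-- common uncovered neighbour, so they send at least 2D − #uncovered = t + 3j edges into the j
-- triangles.  Three disjoint uncovered edges then send more than 12 edges into one triangle, and
-- two of these edges, together with two distinct vertices of that triangle, form two new
-- triangles replacing it.  Once t triangles are found, each extends in turn to a blue B_k avoiding
-- everything used so far: counting the degrees of its three vertices shows that one of its edges
-- has k − 1 common neighbours outside.  Lower bound: colour two disjoint K_{n−1} red and leave
-- t − 1 further hub vertices; every blue triangle, hence every blue book, contains a hub.

open import Defs renaming (sym to col-sym)
import Algebra.Properties.CommutativeSemigroup
open import Data.Bool using (Bool; true; false; _∧_; _∨_; not; if_then_else_)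
open import Data.Bool.Properties using (∧-conicalˡ; ∧-conicalʳ; ∨-conicalˡ; ∨-conicalʳ; ∧-identityʳ; ∧-zeroʳ; ∧-distribʳ-∨)
import Data.Bool.Properties as Bool
open import Data.Empty using (⊥; ⊥-elim)
open import Data.Fin using (Fin; zero; suc; toℕ; _≟_; cast; splitAt; join; inject≤; fromℕ<)
import Data.Fin as Fin
open import Data.Fin.Properties
  using (toℕ-injective; suc-injective; any?; 0≢1+n; toℕ-cast; join-splitAt; inject≤-injective; pigeonhole; toℕ<n; toℕ-fromℕ<)
open import Data.List using (List; []; _∷_; length)
open import Data.List.Relation.Unary.All using (All; []; _∷_)
import Data.List.Relation.Unary.All as All
open import Data.Nat using (ℕ; zero; suc; _+_; _*_; _∸_; _≤_; _<_; z≤n; s≤s; _≤?_; _<?_; pred)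
open import Data.Nat.Properties
  using ( *-comm; *-identityʳ; *-monoʳ-<; *-monoʳ-≤; *-monoˡ-≤; *-suc; *-zeroʳ; +-cancelʳ-≤; +-cancelˡ-<; +-cancelˡ-≤
        ; +-comm; +-identityʳ; +-mono-≤; +-monoʳ-≤; +-monoˡ-<; +-monoˡ-≤; +-suc; +-∸-assoc; <-irrefl; <-≤-trans; <⇒≢
        ; <⇒≤; <⇒≱; m≤m+n; m≤n+m; n<1+n; n≢0⇒n>0; n≤1+n; ≤-pred; ≤-refl; ≤-reflexive; ≤-trans; ≤⇒≯; ≮⇒≥; ≰⇒>
        ; +-commutativeSemigroup; module ≤-Reasoning )
open import Data.Nat.Solver using (module +-*-Solver)
open import Data.Product using (Σ; _×_; _,_; proj₁; proj₂; ∃; ∃₂)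
open import Data.Sum using (_⊎_; inj₁; inj₂)
import Data.Sum as Sum
open import Data.Sum.Properties using (inj₂-injective)
open import Function using (_∘_)
open import Relation.Binary.PropositionalEquality
open import Relation.Nullary using (¬_; yes; no; Dec; _×-dec_)
open import Relation.Nullary.Decidable using (⌊_⌋)

open +-*-Solver
open Algebra.Properties.CommutativeSemigroup +-commutativeSemigroup using () renaming (interchange to +-interchange)

-- Counting over Fin n

∑ : ∀ {n} → (Fin n → ℕ) → ℕ
∑ {zero} f = 0
∑ {suc n} f = f zero + ∑ (f ∘ suc)

𝟙 : Bool → ℕ
𝟙 true = 1
𝟙 false = 0

count : ∀ {n} → (Fin n → Bool) → ℕ
count P = ∑ (𝟙 ∘ P)

𝟙≤1 : ∀ b → 𝟙 b ≤ 1
𝟙≤1 true = ≤-refl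
𝟙≤1 false = z≤n

∑-cong : ∀ {n} {f g : Fin n → ℕ} → (∀ i → f i ≡ g i) → ∑ f ≡ ∑ g
∑-cong {zero} h = refl
∑-cong {suc n} h = cong₂ _+_ (h zero) (∑-cong (h ∘ suc))

∑-mono-≤ : ∀ {n} {f g : Fin n → ℕ} → (∀ i → f i ≤ g i) → ∑ f ≤ ∑ g
∑-mono-≤ {zero} h = z≤n
∑-mono-≤ {suc n} h = +-mono-≤ (h zero) (∑-mono-≤ (h ∘ suc))

∑-+ : ∀ {n} (f g : Fin n → ℕ) → ∑ (λ i → f i + g i) ≡ ∑ f + ∑ g
∑-+ {zero} f g = refl
∑-+ {suc n} f g = trans (cong (f zero + g zero +_) (∑-+ (f ∘ suc) (g ∘ suc)))
  (+-interchange (f zero) (g zero) (∑ (f ∘ suc)) (∑ (g ∘ suc)))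

∑-const : ∀ {n} c → ∑ {n} (λ _ → c) ≡ n * c
∑-const {zero} c = refl
∑-const {suc n} c = cong (c +_) (∑-const {n} c)

∑-+₃ : ∀ {n} (f g h : Fin n → ℕ) → ∑ (λ i → f i + (g i + h i)) ≡ ∑ f + (∑ g + ∑ h)
∑-+₃ f g h = trans (∑-+ f (λ i → g i + h i)) (cong (∑ f +_) (∑-+ g h))

∑-pigeonhole : ∀ {n} (f : Fin n → ℕ) c → n * c < ∑ f → ∃ λ i → c < f i
∑-pigeonhole {zero} f c ()
∑-pigeonhole {suc n} f c h with c <? f zero
... | yes c<f0 = zero , c<f0
... | no c≮f0 with ∑-pigeonhole (f ∘ suc) c (+-cancelˡ-< c _ _ (≤-trans h (+-monoˡ-≤ _ (≮⇒≥ c≮f0))))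
... | i , c<fi = suc i , c<fi

count-const-true : ∀ {n} → count {n} (λ _ → true) ≡ n
count-const-true {n} = trans (∑-const {n} 1) (*-identityʳ n)

count≤n : ∀ {n} (P : Fin n → Bool) → count P ≤ n
count≤n {n} P = subst (count P ≤_) (count-const-true {n}) (∑-mono-≤ (𝟙≤1 ∘ P))

count-const-false : ∀ {n} → count {n} (λ _ → false) ≡ 0
count-const-false {n} = trans (∑-const {n} 0) (*-zeroʳ n)

count-mono : ∀ {n} (P Q : Fin n → Bool) → (∀ i → P i ≡ true → Q i ≡ true) → count P ≤ count Q
count-mono P Q h = ∑-mono-≤ (λ i → 𝟙-mono (P i) (Q i) (h i))
  where
  𝟙-mono : ∀ a b → (a ≡ true → b ≡ true) → 𝟙 a ≤ 𝟙 b
  𝟙-mono true b a⇒b rewrite a⇒b refl = ≤-refl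
  𝟙-mono false b _ = z≤n

count-cong : ∀ {n} {P Q : Fin n → Bool} → (∀ i → P i ≡ Q i) → count P ≡ count Q
count-cong h = ∑-cong (cong 𝟙 ∘ h)

witness : ∀ {n} (P : Fin n → Bool) → 1 ≤ count P → ∃ λ v → P v ≡ true
witness {suc n} P h with P zero in eq
... | true = zero , eq
... | false with witness (P ∘ suc) h
... | v , Pv = suc v , Pv

count-split : ∀ {n} (Q P : Fin n → Bool) → count P ≡ count (λ w → Q w ∧ P w) + count (λ w → not (Q w) ∧ P w)
count-split Q P = trans (∑-cong (λ i → 𝟙-split (Q i) (P i))) (∑-+ (λ i → 𝟙 (Q i ∧ P i)) (λ i → 𝟙 (not (Q i) ∧ P i)))
  where
  𝟙-split : ∀ q p → 𝟙 p ≡ 𝟙 (q ∧ p) + 𝟙 (not q ∧ p)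
  𝟙-split true p = sym (+-identityʳ _)
  𝟙-split false p = refl

count-∨-≤ : ∀ {n} (P Q : Fin n → Bool) → count (λ w → P w ∨ Q w) ≤ count P + count Q
count-∨-≤ P Q = ≤-trans (∑-mono-≤ (λ i → 𝟙-∨ (P i) (Q i))) (≤-reflexive (∑-+ (𝟙 ∘ P) (𝟙 ∘ Q)))
  where
  𝟙-∨ : ∀ a b → 𝟙 (a ∨ b) ≤ 𝟙 a + 𝟙 b
  𝟙-∨ true b = s≤s z≤n
  𝟙-∨ false b = ≤-refl

count-∨-disjoint : ∀ {n} (P Q : Fin n → Bool) → (∀ w → P w ≡ true → Q w ≡ true → ⊥) →
  count (λ w → P w ∨ Q w) ≡ count P + count Q
count-∨-disjoint P Q disj = trans (∑-cong (λ i → 𝟙-∨ (P i) (Q i) (disj i))) (∑-+ (𝟙 ∘ P) (𝟙 ∘ Q))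
  where
  𝟙-∨ : ∀ a b → (a ≡ true → b ≡ true → ⊥) → 𝟙 (a ∨ b) ≡ 𝟙 a + 𝟙 b
  𝟙-∨ true true d = ⊥-elim (d refl refl)
  𝟙-∨ true false d = refl
  𝟙-∨ false b d = refl

count-complement : ∀ {n} (P : Fin n → Bool) → count P + count (not ∘ P) ≡ n
count-complement {n} P = trans (sym (∑-+ (𝟙 ∘ P) (𝟙 ∘ not ∘ P))) (trans (∑-cong (λ i → 𝟙-not (P i))) (count-const-true {n}))
  where
  𝟙-not : ∀ b → 𝟙 b + 𝟙 (not b) ≡ 1
  𝟙-not true = refl
  𝟙-not false = refl

-- Inclusion–exclusion, using |P ∪ Q| ≤ n.
count-∧-lower : ∀ {n} (P Q : Fin n → Bool) → count P + count Q ≤ count (λ w → P w ∧ Q w) + n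
count-∧-lower {n} P Q = begin
  count P + count Q                                  ≡⟨ sym (∑-+ (𝟙 ∘ P) (𝟙 ∘ Q)) ⟩
  ∑ (λ i → 𝟙 (P i) + 𝟙 (Q i))                        ≤⟨ ∑-mono-≤ (λ i → 𝟙-∧ (P i) (Q i)) ⟩
  ∑ (λ i → 𝟙 (P i ∧ Q i) + 1)                        ≡⟨ ∑-+ (λ i → 𝟙 (P i ∧ Q i)) (λ _ → 1) ⟩
  count (λ w → P w ∧ Q w) + ∑ {n} (λ _ → 1)          ≡⟨ cong (count (λ w → P w ∧ Q w) +_) (count-const-true {n}) ⟩
  count (λ w → P w ∧ Q w) + n                        ∎
  where
  open ≤-Reasoning
  𝟙-∧ : ∀ a b → 𝟙 a + 𝟙 b ≤ 𝟙 (a ∧ b) + 1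
  𝟙-∧ true true = ≤-refl
  𝟙-∧ true false = ≤-refl
  𝟙-∧ false b = +-monoʳ-≤ 0 (𝟙≤1 b)

_≡ᵇ_ : ∀ {n} → Fin n → Fin n → Bool
x ≡ᵇ y = ⌊ x ≟ y ⌋

≡ᵇ-refl : ∀ {n} (x : Fin n) → (x ≡ᵇ x) ≡ true
≡ᵇ-refl x with x ≟ x
... | yes _ = refl
... | no x≢x = ⊥-elim (x≢x refl)

≡ᵇ⇒≡ : ∀ {n} {x y : Fin n} → (x ≡ᵇ y) ≡ true → x ≡ y
≡ᵇ⇒≡ {x = x} {y} h with x ≟ y
... | yes x≡y = x≡y

≢⇒≡ᵇ-false : ∀ {n} {x y : Fin n} → x ≢ y → (x ≡ᵇ y) ≡ false
≢⇒≡ᵇ-false {x = x} {y} x≢y with x ≟ y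
... | yes x≡y = ⊥-elim (x≢y x≡y)
... | no _ = refl

count-singleton : ∀ {n} (v : Fin n) (P : Fin n → Bool) → count (λ w → (w ≡ᵇ v) ∧ P w) ≡ 𝟙 (P v)
count-singleton {suc n} zero P = trans (cong (𝟙 (P zero) +_) (count-const-false {n})) (+-identityʳ _)
count-singleton {suc n} (suc v) P =
  trans (∑-cong (λ w → cong (λ b → 𝟙 (b ∧ P (suc w))) (≡ᵇ-suc w v))) (count-singleton v (P ∘ suc))
  where
  ≡ᵇ-suc : ∀ {n} (x y : Fin n) → (suc x ≡ᵇ suc y) ≡ (x ≡ᵇ y)
  ≡ᵇ-suc x y with x ≟ y
  ... | yes _ = refl
  ... | no _ = refl

_─_ : ∀ {n} → (Fin n → Bool) → Fin n → Fin n → Bool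
(P ─ v) w = not (w ≡ᵇ v) ∧ P w

─-≢ : ∀ {n} (P : Fin n → Bool) {v w} → (P ─ v) w ≡ true → w ≢ v
─-≢ P {v} h refl with v ≟ v
... | no v≢v = v≢v refl
─-≢ P () refl | yes _

─-intro : ∀ {n} (P : Fin n → Bool) {v w} → P w ≡ true → w ≢ v → (P ─ v) w ≡ true
─-intro P Pw w≢v rewrite ≢⇒≡ᵇ-false w≢v = Pw

─-⊆ : ∀ {n} (P : Fin n → Bool) {v w} → (P ─ v) w ≡ true → P w ≡ true
─-⊆ P {v} {w} h = ∧-conicalʳ (not (w ≡ᵇ v)) _ h

count-─ : ∀ {n} (P : Fin n → Bool) v → count P ≡ 𝟙 (P v) + count (P ─ v)
count-─ P v = trans (count-split (_≡ᵇ v) P) (cong (_+ count (P ─ v)) (count-singleton v P))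

count-─-≤ : ∀ {n} (P : Fin n → Bool) v → count P ≤ suc (count (P ─ v))
count-─-≤ P v = ≤-trans (≤-reflexive (count-─ P v)) (+-monoˡ-≤ _ (𝟙≤1 (P v)))

witness-avoiding : ∀ {n} (P : Fin n → Bool) (xs : List (Fin n)) → length xs < count P →
  ∃ λ w → P w ≡ true × All (w ≢_) xs
witness-avoiding P [] h = let w , Pw = witness P h in w , Pw , []
witness-avoiding P (x ∷ xs) h with witness-avoiding (P ─ x) xs (≤-pred (≤-trans h (count-─-≤ P x)))
... | w , Pw , w∉xs = w , ─-⊆ P Pw , ─-≢ P Pw ∷ w∉xs

pick-distinct : ∀ {n} m (P : Fin n → Bool) → m ≤ count P →
  Σ (Fin m → Fin n) λ g → (∀ i j → g i ≡ g j → i ≡ j) × (∀ i → P (g i) ≡ true)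
pick-distinct zero P h = (λ ()) , (λ ()) , (λ ())
pick-distinct (suc m) P h with witness P (≤-trans (s≤s z≤n) h)
... | v , Pv with pick-distinct m (P ─ v) (≤-pred (≤-trans h (count-─-≤ P v)))
... | g , g-inj , Pg = g′ , g′-inj , Pg′
  where
  g′ : Fin (suc m) → _
  g′ zero = v
  g′ (suc i) = g i
  g′-inj : ∀ i j → g′ i ≡ g′ j → i ≡ j
  g′-inj zero zero e = refl
  g′-inj zero (suc j) e = ⊥-elim (─-≢ P (Pg j) (sym e))
  g′-inj (suc i) zero e = ⊥-elim (─-≢ P (Pg i) e)
  g′-inj (suc i) (suc j) e = cong suc (g-inj i j e)
  Pg′ : ∀ i → P (g′ i) ≡ true
  Pg′ zero = Pv
  Pg′ (suc i) = ─-⊆ P (Pg i)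

⋁ : ∀ {m} → (Fin m → Bool) → Bool
⋁ {zero} f = false
⋁ {suc m} f = f zero ∨ ⋁ (f ∘ suc)

⋁-intro : ∀ {m} (f : Fin m → Bool) i → f i ≡ true → ⋁ f ≡ true
⋁-intro f zero fi rewrite fi = refl
⋁-intro f (suc i) fi with f zero
... | true = refl
... | false = ⋁-intro (f ∘ suc) i fi

⋁-elim : ∀ {m} (f : Fin m → Bool) → ⋁ f ≡ true → ∃ λ i → f i ≡ true
⋁-elim {suc m} f h with f zero in f0
... | true = zero , f0
... | false = let i , fi = ⋁-elim (f ∘ suc) h in suc i , fi

⋁-none : ∀ {m} (f : Fin m → Bool) → (∀ i → f i ≡ false) → ⋁ f ≡ false
⋁-none {zero} f h = refl
⋁-none {suc m} f h rewrite h zero = ⋁-none (f ∘ suc) (h ∘ suc)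

count-⋁-≤ : ∀ {n m} (S : Fin m → Fin n → Bool) (P : Fin n → Bool) →
  count (λ w → ⋁ (λ r → S r w) ∧ P w) ≤ ∑ (λ r → count (λ w → S r w ∧ P w))
count-⋁-≤ {n} {zero} S P = ≤-reflexive (count-const-false {n})
count-⋁-≤ {n} {suc m} S P = begin
  count (λ w → ⋁ (λ r → S r w) ∧ P w)
    ≡⟨ count-cong (λ w → ∧-distribʳ-∨ (P w) (S zero w) (⋁ (λ r → S (suc r) w))) ⟩
  count (λ w → (S zero w ∧ P w) ∨ (⋁ (λ r → S (suc r) w) ∧ P w))
    ≤⟨ count-∨-≤ (λ w → S zero w ∧ P w) (λ w → ⋁ (λ r → S (suc r) w) ∧ P w) ⟩
  count (λ w → S zero w ∧ P w) + count (λ w → ⋁ (λ r → S (suc r) w) ∧ P w)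
    ≤⟨ +-monoʳ-≤ _ (count-⋁-≤ (S ∘ suc) P) ⟩
  ∑ (λ r → count (λ w → S r w ∧ P w)) ∎
  where open ≤-Reasoning

count-⋁-disjoint : ∀ {n m} (S : Fin m → Fin n → Bool) →
  (∀ r r′ w → S r w ≡ true → S r′ w ≡ true → r ≡ r′) →
  count (λ w → ⋁ (λ r → S r w)) ≡ ∑ (λ r → count (S r))
count-⋁-disjoint {n} {zero} S disj = count-const-false {n}
count-⋁-disjoint {n} {suc m} S disj =
  trans (count-∨-disjoint (S zero) (λ w → ⋁ (λ r → S (suc r) w)) apart)
        (cong (count (S zero) +_) (count-⋁-disjoint (S ∘ suc) (λ r r′ w a b → suc-injective (disj (suc r) (suc r′) w a b))))
  where
  apart : ∀ w → S zero w ≡ true → ⋁ (λ r → S (suc r) w) ≡ true → ⊥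
  apart w a b with ⋁-elim (λ r → S (suc r) w) b
  ... | r , b′ with disj zero (suc r) w a b′
  ... | ()

_∈ᵇ_ : ∀ {n m} → Fin n → (Fin m → Fin n) → Bool
w ∈ᵇ g = ⋁ (λ s → w ≡ᵇ g s)

∈ᵇ-image : ∀ {n m} (g : Fin m → Fin n) s → (g s ∈ᵇ g) ≡ true
∈ᵇ-image g s = ⋁-intro _ s (≡ᵇ-refl (g s))

∈ᵇ⇒∃ : ∀ {n m} (g : Fin m → Fin n) w → (w ∈ᵇ g) ≡ true → ∃ λ s → w ≡ g s
∈ᵇ⇒∃ g w h = let s , e = ⋁-elim _ h in s , ≡ᵇ⇒≡ e

∉ᵇ-intro : ∀ {n m} (g : Fin m → Fin n) {w} → (∀ s → w ≢ g s) → (w ∈ᵇ g) ≡ false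
∉ᵇ-intro g {w} h = ⋁-none _ λ s → ≢⇒≡ᵇ-false (h s)

∉ᵇ⇒≢ : ∀ {n m} (g : Fin m → Fin n) {w} → (w ∈ᵇ g) ≡ false → ∀ s → w ≢ g s
∉ᵇ⇒≢ g w∉g s refl with trans (sym w∉g) (∈ᵇ-image g s)
... | ()

count-image-∧-≤ : ∀ {n m} (g : Fin m → Fin n) (P : Fin n → Bool) →
  count (λ w → (w ∈ᵇ g) ∧ P w) ≤ ∑ (λ s → 𝟙 (P (g s)))
count-image-∧-≤ g P = ≤-trans (count-⋁-≤ (λ s w → w ≡ᵇ g s) P) (≤-reflexive (∑-cong (λ s → count-singleton (g s) P)))

count-image-≤ : ∀ {n m} (g : Fin m → Fin n) → count (_∈ᵇ g) ≤ m
count-image-≤ {m = m} g = begin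
  count (_∈ᵇ g)                       ≡⟨ count-cong (λ w → sym (∧-identityʳ (w ∈ᵇ g))) ⟩
  count (λ w → (w ∈ᵇ g) ∧ true)       ≤⟨ count-image-∧-≤ g (λ _ → true) ⟩
  ∑ {m} (λ _ → 1)                      ≡⟨ count-const-true {m} ⟩
  m                                   ∎
  where open ≤-Reasoning

count-image : ∀ {n m} (g : Fin m → Fin n) → (∀ i j → g i ≡ g j → i ≡ j) → count (_∈ᵇ g) ≡ m
count-image {m = m} g g-inj = begin
  count (_∈ᵇ g)                                   ≡⟨ count-⋁-disjoint (λ s w → w ≡ᵇ g s) disjoint ⟩
  ∑ (λ s → count (_≡ᵇ g s))                       ≡⟨ ∑-cong (λ s → trans (count-cong (λ w → sym (∧-identityʳ (w ≡ᵇ g s)))) (count-singleton (g s) (λ _ → true))) ⟩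
  ∑ {m} (λ _ → 1)                                  ≡⟨ count-const-true {m} ⟩
  m                                               ∎
  where
  open ≡-Reasoning
  disjoint : ∀ r r′ w → (w ≡ᵇ g r) ≡ true → (w ≡ᵇ g r′) ≡ true → r ≡ r′
  disjoint r r′ w a b = g-inj r r′ (trans (sym (≡ᵇ⇒≡ a)) (≡ᵇ⇒≡ b))

∑-comm : ∀ {m n} (f : Fin m → Fin n → ℕ) → ∑ (λ i → ∑ (f i)) ≡ ∑ (λ k → ∑ (λ i → f i k))
∑-comm {zero} {n} f = sym (trans (∑-const {n} 0) (*-zeroʳ n))
∑-comm {suc m} f = trans (cong (∑ (f zero) +_) (∑-comm (f ∘ suc))) (sym (∑-+ (f zero) (λ k → ∑ (λ i → f (suc i) k))))

two-heavy : (g : Fin 3 → ℕ) → (∀ i → g i ≤ 6) → 12 < ∑ g → ∃₂ λ i i′ → i ≢ i′ × 4 < g i × 3 < g i′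
two-heavy g ≤6 h with 4 <? g zero | 4 <? g (suc zero) | 4 <? g (suc (suc zero))
                    | 3 <? g zero | 3 <? g (suc zero) | 3 <? g (suc (suc zero))
... | yes p | _     | _     | _     | yes q | _     = zero , suc zero , (λ ()) , p , q
... | yes p | _     | _     | _     | no _  | yes q = zero , suc (suc zero) , (λ ()) , p , q
... | no _  | yes p | _     | yes q | _     | _     = suc zero , zero , (λ ()) , p , q
... | no _  | yes p | _     | no _  | _     | yes q = suc zero , suc (suc zero) , (λ ()) , p , q
... | no _  | no _  | yes p | yes q | _     | _     = suc (suc zero) , zero , (λ ()) , p , q
... | no _  | no _  | yes p | no _  | yes q | _     = suc (suc zero) , suc zero , (λ ()) , p , q
... | yes _ | _     | _     | _     | no q₁ | no q₂ = ⊥-elim (≤⇒≯ (+-mono-≤ (≤6 zero) (+-mono-≤ (≮⇒≥ q₁) (+-monoˡ-≤ 0 (≮⇒≥ q₂)))) h)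
... | no _  | yes _ | _     | no q₀ | _     | no q₂ = ⊥-elim (≤⇒≯ (+-mono-≤ (≮⇒≥ q₀) (+-mono-≤ (≤6 (suc zero)) (+-monoˡ-≤ 0 (≮⇒≥ q₂)))) h)
... | no _  | no _  | yes _ | no q₀ | no q₁ | _     = ⊥-elim (≤⇒≯ (+-mono-≤ (≮⇒≥ q₀) (+-mono-≤ (≮⇒≥ q₁) (+-monoˡ-≤ 0 (≤6 (suc (suc zero)))))) h)
... | no p₀ | no p₁ | no p₂ | _     | _     | _     = ⊥-elim (≤⇒≯ (+-mono-≤ (≮⇒≥ p₀) (+-mono-≤ (≮⇒≥ p₁) (+-monoˡ-≤ 0 (≮⇒≥ p₂)))) h)

-- Triangle packings and books in a graph

module SimpleGraph {N : ℕ} (A : Fin N → Fin N → Bool)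
  (A-sym : ∀ x y → A x y ≡ A y x) (A-irrefl : ∀ x → A x x ≡ false) where

  adjacent⇒≢ : ∀ {x y} → A x y ≡ true → x ≢ y
  adjacent⇒≢ {x} Axy refl with trans (sym Axy) (A-irrefl x)
  ... | ()

  adjacent-sym : ∀ {x y} → A x y ≡ true → A y x ≡ true
  adjacent-sym {x} {y} Axy = trans (A-sym y x) Axy

  Triangle : Set
  Triangle = Fin 3 → Fin N

  IsTriangle : Triangle → Set
  IsTriangle τ = ∀ s s′ → s ≢ s′ → A (τ s) (τ s′) ≡ true

  triangle-injective : ∀ {τ} → IsTriangle τ → ∀ s s′ → τ s ≡ τ s′ → s ≡ s′
  triangle-injective isT s s′ e with s ≟ s′
  ... | yes s≡s′ = s≡s′
  ... | no s≢s′ = ⊥-elim (adjacent⇒≢ (isT s s′ s≢s′) e)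

  ⟨_,_,_⟩ : Fin N → Fin N → Fin N → Triangle
  ⟨ x , y , z ⟩ zero = x
  ⟨ x , y , z ⟩ (suc zero) = y
  ⟨ x , y , z ⟩ (suc (suc zero)) = z

  ⟨⟩-isTriangle : ∀ {x y z} → A x y ≡ true → A x z ≡ true → A y z ≡ true → IsTriangle ⟨ x , y , z ⟩
  ⟨⟩-isTriangle Axy Axz Ayz zero (suc zero) _ = Axy
  ⟨⟩-isTriangle Axy Axz Ayz zero (suc (suc zero)) _ = Axz
  ⟨⟩-isTriangle Axy Axz Ayz (suc zero) zero _ = adjacent-sym Axy
  ⟨⟩-isTriangle Axy Axz Ayz (suc zero) (suc (suc zero)) _ = Ayz
  ⟨⟩-isTriangle Axy Axz Ayz (suc (suc zero)) zero _ = adjacent-sym Axz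
  ⟨⟩-isTriangle Axy Axz Ayz (suc (suc zero)) (suc zero) _ = adjacent-sym Ayz
  ⟨⟩-isTriangle Axy Axz Ayz zero zero s≢s = ⊥-elim (s≢s refl)
  ⟨⟩-isTriangle Axy Axz Ayz (suc zero) (suc zero) s≢s = ⊥-elim (s≢s refl)
  ⟨⟩-isTriangle Axy Axz Ayz (suc (suc zero)) (suc (suc zero)) s≢s = ⊥-elim (s≢s refl)

  edgesInto : Fin N → Triangle → ℕ
  edgesInto x τ = count (λ s → A x (τ s))

  common-neighbour : ∀ x y τ (xs : List (Fin 3)) → 3 + length xs < edgesInto x τ + edgesInto y τ →
    ∃ λ s → (A x (τ s) ≡ true × A y (τ s) ≡ true) × All (s ≢_) xs
  common-neighbour x y τ xs h
    with witness-avoiding (λ s → A x (τ s) ∧ A y (τ s)) xs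
           (+-cancelˡ-< 3 _ _ (<-≤-trans h (≤-trans (count-∧-lower (λ s → A x (τ s)) (λ s → A y (τ s)))
                                                   (≤-reflexive (+-comm _ 3)))))
  ... | s , both , s∉xs = s , (∧-conicalˡ _ _ both , ∧-conicalʳ _ _ both) , s∉xs

  -- A packing of j vertex-disjoint triangles; disjointness is certified by
  -- block, which labels every vertex of the r-th triangle by r.
  record Packing (j : ℕ) : Set where
    field
      triangle : Fin j → Triangle
      isTriangle : ∀ r → IsTriangle (triangle r)
      block : Fin N → ℕ
      block-triangle : ∀ r s → block (triangle r s) ≡ toℕ r

    covered : Fin N → Bool
    covered w = ⋁ (λ r → w ∈ᵇ triangle r)

    free : Fin N → Bool
    free w = not (covered w)

    covered-triangle : ∀ r s → covered (triangle r s) ≡ true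
    covered-triangle r s = ⋁-intro _ r (∈ᵇ-image (triangle r) s)

    free≢covered : ∀ {v w} → free v ≡ true → covered w ≡ true → v ≢ w
    free≢covered fv cw refl with trans (sym (cong not cw)) fv
    ... | ()

    free≢triangle : ∀ {v} r s → free v ≡ true → v ≢ triangle r s
    free≢triangle r s fv = free≢covered fv (covered-triangle r s)

    triangles-disjoint : ∀ {r r′} s s′ → triangle r s ≡ triangle r′ s′ → r ≡ r′
    triangles-disjoint {r} {r′} s s′ e =
      toℕ-injective (trans (sym (block-triangle r s)) (trans (cong block e) (block-triangle r′ s′)))

    count-covered : count covered ≡ j * 3
    count-covered = begin
      count covered                    ≡⟨ count-⋁-disjoint (λ r w → w ∈ᵇ triangle r) disjoint ⟩
      ∑ (λ r → count (_∈ᵇ triangle r)) ≡⟨ ∑-cong (λ r → count-image (triangle r) (triangle-injective (isTriangle r))) ⟩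
      ∑ {j} (λ _ → 3)                  ≡⟨ ∑-const {j} 3 ⟩
      j * 3                            ∎
      where
      open ≡-Reasoning
      disjoint : ∀ r r′ w → (w ∈ᵇ triangle r) ≡ true → (w ∈ᵇ triangle r′) ≡ true → r ≡ r′
      disjoint r r′ w a b with ∈ᵇ⇒∃ (triangle r) w a | ∈ᵇ⇒∃ (triangle r′) w b
      ... | s , e | s′ , e′ = triangles-disjoint s s′ (trans (sym e) e′)

    edgesInto-covered : ∀ x → count (λ w → covered w ∧ A x w) ≤ ∑ (λ r → edgesInto x (triangle r))
    edgesInto-covered x = ≤-trans (count-⋁-≤ (λ r w → w ∈ᵇ triangle r) (A x))
                                  (∑-mono-≤ (λ r → count-image-∧-≤ (triangle r) (A x)))

  open Packing public

  empty-packing : Packing 0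
  empty-packing = record { triangle = λ () ; isTriangle = λ () ; block = λ _ → 0 ; block-triangle = λ () }

  add-triangle : ∀ {j} (P : Packing j) (τ : Triangle) → IsTriangle τ → (∀ s → free P (τ s) ≡ true) → Packing (suc j)
  add-triangle {j} P τ isT τ-free = record
    { triangle = triangle′ ; isTriangle = isTriangle′ ; block = block′ ; block-triangle = block-triangle′ }
    where
    triangle′ : Fin (suc j) → Triangle
    triangle′ zero = τ
    triangle′ (suc r) = triangle P r
    isTriangle′ : ∀ r → IsTriangle (triangle′ r)
    isTriangle′ zero = isT
    isTriangle′ (suc r) = isTriangle P r
    block′ : Fin N → ℕ
    block′ w = if w ∈ᵇ τ then 0 else suc (block P w)
    block-triangle′ : ∀ r s → block′ (triangle′ r s) ≡ toℕ r
    block-triangle′ zero s rewrite ∈ᵇ-image τ s = refl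
    block-triangle′ (suc r) s
      rewrite ∉ᵇ-intro τ (λ s′ e → free≢triangle P r s (τ-free s′) (sym e)) = cong suc (block-triangle P r s)

  -- A vertex that may join the packing when triangle r is dismantled.
  Fresh : ∀ {j} → Packing j → Fin j → Fin N → Set
  Fresh P r v = free P v ≡ true ⊎ ∃ λ s → v ≡ triangle P r s

  fresh-apart : ∀ {j} (P : Packing j) {r r′ v} → r′ ≢ r → Fresh P r v → ∀ s → triangle P r′ s ≢ v
  fresh-apart P {r′ = r′} r′≢r (inj₁ fv) s e = free≢triangle P r′ s fv (sym e)
  fresh-apart P r′≢r (inj₂ (s′ , refl)) s e = r′≢r (triangles-disjoint P s s′ e)

  exchange : ∀ {j} (P : Packing j) (r : Fin j) (τ₀ τ₁ : Triangle) → IsTriangle τ₀ → IsTriangle τ₁ →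
    (∀ s s′ → τ₁ s ≢ τ₀ s′) → (∀ s → Fresh P r (τ₀ s)) → (∀ s → Fresh P r (τ₁ s)) → Packing (suc j)
  exchange {j} P r τ₀ τ₁ isT₀ isT₁ τ₁≢τ₀ fresh₀ fresh₁ = record
    { triangle = triangle′ ; isTriangle = isTriangle′ ; block = block′ ; block-triangle = block-triangle′ }
    where
    replaced : Fin j → Triangle
    replaced r′ with r′ ≟ r
    ... | yes _ = τ₁
    ... | no _ = triangle P r′
    triangle′ : Fin (suc j) → Triangle
    triangle′ zero = τ₀
    triangle′ (suc r′) = replaced r′
    isTriangle′ : ∀ r′ → IsTriangle (triangle′ r′)
    isTriangle′ zero = isT₀
    isTriangle′ (suc r′) with r′ ≟ r
    ... | yes _ = isT₁
    ... | no _ = isTriangle P r′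
    block′ : Fin N → ℕ
    block′ w = if w ∈ᵇ τ₀ then 0 else if w ∈ᵇ τ₁ then suc (toℕ r) else suc (block P w)
    block-triangle′ : ∀ r′ s → block′ (triangle′ r′ s) ≡ toℕ r′
    block-triangle′ zero s rewrite ∈ᵇ-image τ₀ s = refl
    block-triangle′ (suc r′) s with r′ ≟ r
    ... | yes refl rewrite ∉ᵇ-intro τ₀ (τ₁≢τ₀ s) | ∈ᵇ-image τ₁ s = refl
    ... | no r′≢r
      rewrite ∉ᵇ-intro τ₀ (λ s′ → fresh-apart P r′≢r (fresh₀ s′) s)
            | ∉ᵇ-intro τ₁ (λ s′ → fresh-apart P r′≢r (fresh₁ s′) s) = cong suc (block-triangle P r′ s)

  free-neighbours : ∀ {j} → Packing j → Fin N → Fin N → Bool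
  free-neighbours P v w = free P w ∧ A v w

  FreeTriangle : ∀ {j} → Packing j → Fin N → Fin N → Fin N → Set
  FreeTriangle P x y z = (A x y ≡ true × A x z ≡ true × A y z ≡ true) × (free P x ≡ true × free P y ≡ true × free P z ≡ true)

  free-triangle? : ∀ {j} (P : Packing j) → Dec (∃ λ x → ∃ λ y → ∃ λ z → FreeTriangle P x y z)
  free-triangle? P = any? λ x → any? λ y → any? λ z →
    ((A x y Bool.≟ true) ×-dec (A x z Bool.≟ true) ×-dec (A y z Bool.≟ true)) ×-dec
    ((free P x Bool.≟ true) ×-dec (free P y Bool.≟ true) ×-dec (free P z Bool.≟ true))

  record FreeEdge {j} (P : Packing j) : Set where
    field
      x y : Fin N
      x-free : free P x ≡ true
      y-free : free P y ≡ true
      adjacent : A x y ≡ true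

  open FreeEdge

  _∉ₑ_ : ∀ {j} {P : Packing j} → Fin N → FreeEdge P → Set
  z ∉ₑ e = x e ≢ z × y e ≢ z

  Disjoint : ∀ {j} {P : Packing j} → FreeEdge P → FreeEdge P → Set
  Disjoint e e′ = x e ∉ₑ e′ × y e ∉ₑ e′

  Disjoint-sym : ∀ {j} {P : Packing j} {e e′ : FreeEdge P} → Disjoint e e′ → Disjoint e′ e
  Disjoint-sym ((a , b) , (c , d)) = (≢-sym a , ≢-sym c) , (≢-sym b , ≢-sym d)

  sends : ∀ {j} {P : Packing j} → FreeEdge P → Triangle → ℕ
  sends e τ = edgesInto (x e) τ + edgesInto (y e) τ

  sends≤6 : ∀ {j} {P : Packing j} (e : FreeEdge P) τ → sends e τ ≤ 6
  sends≤6 e τ = +-mono-≤ (count≤n (λ s → A (x e) (τ s))) (count≤n (λ s → A (y e) (τ s)))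

  -- The new triangles are (x′, y′, b) and (x, y, a) for common neighbours a ≢ b in τ.
  exchange-along : ∀ {j} (P : Packing j) r (e e′ : FreeEdge P) → Disjoint e e′ →
    4 < sends e (triangle P r) → 3 < sends e′ (triangle P r) → Packing (suc j)
  exchange-along P r e e′ e⊥e′ heavy heavy′
    with common-neighbour (x e′) (y e′) (triangle P r) [] heavy′
  ... | sb , (x′b , y′b) , [] with common-neighbour (x e) (y e) (triangle P r) (sb ∷ []) heavy
  ... | sa , (xa , ya) , sa≢sb ∷ [] =
    exchange P r τ₀ τ₁ (⟨⟩-isTriangle (adjacent e′) x′b y′b) (⟨⟩-isTriangle (adjacent e) xa ya) apart fresh₀ fresh₁
    where
    τ = triangle P r
    τ₀ = ⟨ x e′ , y e′ , τ sb ⟩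
    τ₁ = ⟨ x e , y e , τ sa ⟩
    apart : ∀ s s′ → τ₁ s ≢ τ₀ s′
    apart zero zero = ≢-sym (proj₁ (proj₁ e⊥e′))
    apart zero (suc zero) = ≢-sym (proj₂ (proj₁ e⊥e′))
    apart zero (suc (suc zero)) = free≢triangle P r sb (x-free e)
    apart (suc zero) zero = ≢-sym (proj₁ (proj₂ e⊥e′))
    apart (suc zero) (suc zero) = ≢-sym (proj₂ (proj₂ e⊥e′))
    apart (suc zero) (suc (suc zero)) = free≢triangle P r sb (y-free e)
    apart (suc (suc zero)) zero = ≢-sym (free≢triangle P r sa (x-free e′))
    apart (suc (suc zero)) (suc zero) = ≢-sym (free≢triangle P r sa (y-free e′))
    apart (suc (suc zero)) (suc (suc zero)) = sa≢sb ∘ triangle-injective (isTriangle P r) sa sb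
    fresh₀ : ∀ s → Fresh P r (τ₀ s)
    fresh₀ zero = inj₁ (x-free e′)
    fresh₀ (suc zero) = inj₁ (y-free e′)
    fresh₀ (suc (suc zero)) = inj₂ (sb , refl)
    fresh₁ : ∀ s → Fresh P r (τ₁ s)
    fresh₁ zero = inj₁ (x-free e)
    fresh₁ (suc zero) = inj₁ (y-free e)
    fresh₁ (suc (suc zero)) = inj₂ (sa , refl)

  module Growth (D t : ℕ) (min-degree : ∀ v → D ≤ count (A v)) (degree-sum : D + D ≡ N + t)
    (t≥1 : 1 ≤ t) (large-degree : 2 ≤ t → 3 * t + 2 ≤ D) (x₀ : Fin N) where

    free-degree : ∀ {j} (P : Packing j) v → D ≤ j * 3 + count (free-neighbours P v)
    free-degree {j} P v = begin
      D                                                                  ≤⟨ min-degree v ⟩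
      count (A v)                                                        ≡⟨ count-split (covered P) (A v) ⟩
      count (λ w → covered P w ∧ A v w) + count (free-neighbours P v)    ≤⟨ +-monoˡ-≤ _ (count-mono _ (covered P) (λ w → ∧-conicalˡ _ _)) ⟩
      count (covered P) + count (free-neighbours P v)                    ≡⟨ cong (_+ count (free-neighbours P v)) (count-covered P) ⟩
      j * 3 + count (free-neighbours P v)                                ∎
      where open ≤-Reasoning

    -- No free vertex sees both ends of a free edge, so the ends send at least
    -- 2D − |free| = N + t − |free| = t + 3j edges into the packing.
    free-edge-sends : ∀ {j} (P : Packing j) → ¬ (∃ λ x → ∃ λ y → ∃ λ z → FreeTriangle P x y z) →
      (e : FreeEdge P) → t + j * 3 ≤ ∑ (λ r → sends e (triangle P r))
    free-edge-sends {j} P none e = +-cancelʳ-≤ c _ _ (begin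
      (t + j * 3) + c                          ≡⟨ solve 3 (λ t u c → (t :+ u) :+ c := (u :+ c) :+ t) refl t (j * 3) c ⟩
      (j * 3 + c) + t                          ≡⟨ cong (_+ t) covered+free ⟩
      N + t                                    ≡⟨ degree-sum ⟨
      D + D                                    ≤⟨ +-mono-≤ (split (x e)) (split (y e)) ⟩
      (cov (x e) + fr (x e)) + (cov (y e) + fr (y e))
                                               ≡⟨ +-interchange (cov (x e)) (fr (x e)) _ _ ⟩
      (cov (x e) + cov (y e)) + (fr (x e) + fr (y e))
                                               ≤⟨ +-mono-≤ (+-mono-≤ (edgesInto-covered P (x e)) (edgesInto-covered P (y e))) free-part ⟩
      (∑ (λ r → edgesInto (x e) (triangle P r)) + ∑ (λ r → edgesInto (y e) (triangle P r))) + c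
                                               ≡⟨ cong (_+ c) (∑-+ (λ r → edgesInto (x e) (triangle P r)) _) ⟨
      ∑ (λ r → sends e (triangle P r)) + c     ∎)
      where
      open ≤-Reasoning
      c = count (free P)
      cov fr : Fin N → ℕ
      cov v = count (λ w → covered P w ∧ A v w)
      fr v = count (free-neighbours P v)
      covered+free : j * 3 + c ≡ N
      covered+free = trans (cong (_+ c) (sym (count-covered P))) (count-complement (covered P))
      split : ∀ v → D ≤ cov v + fr v
      split v = ≤-trans (min-degree v) (≤-reflexive (count-split (covered P) (A v)))
      no-common : ∀ w → free P w ≡ true → A (x e) w ≡ true → A (y e) w ≡ true → ⊥
      no-common w fw xw yw = none (x e , y e , w , (adjacent e , xw , yw) , (x-free e , y-free e , fw))
      𝟙-apart : ∀ f a b → (f ≡ true → a ≡ true → b ≡ true → ⊥) → 𝟙 (f ∧ a) + 𝟙 (f ∧ b) ≤ 𝟙 f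
      𝟙-apart true true true h = ⊥-elim (h refl refl refl)
      𝟙-apart true true false h = ≤-refl
      𝟙-apart true false b h = 𝟙≤1 b
      𝟙-apart false a b h = z≤n
      free-part : fr (x e) + fr (y e) ≤ c
      free-part = ≤-trans (≤-reflexive (sym (∑-+ (𝟙 ∘ free-neighbours P (x e)) (𝟙 ∘ free-neighbours P (y e)))))
                          (∑-mono-≤ (λ w → 𝟙-apart (free P w) (A (x e) w) (A (y e) w) (no-common w)))

    opaque
      free-edge-avoiding : ∀ {j} (P : Packing j) (zs : List (Fin N)) →
        (∀ v → length zs < count (free-neighbours P v)) → Σ (FreeEdge P) λ e → All (_∉ₑ e) zs
      free-edge-avoiding P zs roomy
        with witness-avoiding (free-neighbours P x₀) zs (roomy x₀)
      ... | u , x₀u , u∉zs with witness-avoiding (free-neighbours P u) zs (roomy u)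
      ... | v , uv , v∉zs =
        record { x = u ; y = v ; x-free = ∧-conicalˡ _ _ x₀u ; y-free = ∧-conicalˡ _ _ uv ; adjacent = ∧-conicalʳ _ _ uv } ,
        All.zip (u∉zs , v∉zs)

    three-disjoint-free-edges : ∀ {j} (P : Packing j) → (∀ v → 4 < count (free-neighbours P v)) →
      Σ (Fin 3 → FreeEdge P) λ es → ∀ i i′ → i ≢ i′ → Disjoint (es i) (es i′)
    three-disjoint-free-edges P roomy = es , disjoint
      where
      edge₁ = free-edge-avoiding P [] (λ v → ≤-trans (s≤s z≤n) (roomy v))
      e₁ = proj₁ edge₁
      edge₂ = free-edge-avoiding P (x e₁ ∷ y e₁ ∷ []) (λ v → ≤-trans (s≤s (s≤s (s≤s z≤n))) (roomy v))
      e₂ = proj₁ edge₂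
      edge₃ = free-edge-avoiding P (x e₁ ∷ y e₁ ∷ x e₂ ∷ y e₂ ∷ []) roomy
      e₃ = proj₁ edge₃
      d₁₂ : Disjoint e₁ e₂
      d₁₂ with proj₂ edge₂
      ... | x₁∉e₂ ∷ y₁∉e₂ ∷ [] = x₁∉e₂ , y₁∉e₂
      d₁₃ : Disjoint e₁ e₃
      d₁₃ with proj₂ edge₃
      ... | x₁∉e₃ ∷ y₁∉e₃ ∷ _ = x₁∉e₃ , y₁∉e₃
      d₂₃ : Disjoint e₂ e₃
      d₂₃ with proj₂ edge₃
      ... | _ ∷ _ ∷ x₂∉e₃ ∷ y₂∉e₃ ∷ [] = x₂∉e₃ , y₂∉e₃
      es : Fin 3 → FreeEdge P
      es zero = e₁
      es (suc zero) = e₂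
      es (suc (suc zero)) = e₃
      disjoint : ∀ i i′ → i ≢ i′ → Disjoint (es i) (es i′)
      disjoint zero (suc zero) _ = d₁₂
      disjoint zero (suc (suc zero)) _ = d₁₃
      disjoint (suc zero) (suc (suc zero)) _ = d₂₃
      disjoint (suc zero) zero _ = Disjoint-sym {e = e₁} {e₂} d₁₂
      disjoint (suc (suc zero)) zero _ = Disjoint-sym {e = e₁} {e₃} d₁₃
      disjoint (suc (suc zero)) (suc zero) _ = Disjoint-sym {e = e₂} {e₃} d₂₃
      disjoint zero zero i≢i = ⊥-elim (i≢i refl)
      disjoint (suc zero) (suc zero) i≢i = ⊥-elim (i≢i refl)
      disjoint (suc (suc zero)) (suc (suc zero)) i≢i = ⊥-elim (i≢i refl)

    free-room : ∀ {j} → 1 ≤ j → j < t → (P : Packing j) → ∀ v → 4 < count (free-neighbours P v)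
    free-room {j} j≥1 j<t P v = +-cancelˡ-≤ (j * 3) 5 _ (≤-trans room (free-degree P v))
      where
      room : j * 3 + 5 ≤ D
      room = ≤-trans (≤-trans (≤-reflexive (solve 1 (λ j → j :* con 3 :+ con 5 := con 3 :* (con 1 :+ j) :+ con 2) refl j))
                              (+-monoˡ-≤ 2 (*-monoʳ-≤ 3 j<t)))
                     (large-degree (≤-trans (s≤s j≥1) j<t))

    -- The three edges together send at least 3(t + 3j) > 12j edges into the j triangles.
    overloaded-triangle : ∀ {j} → j < t → (P : Packing j) → ¬ (∃ λ x → ∃ λ y → ∃ λ z → FreeTriangle P x y z) →
      (es : Fin 3 → FreeEdge P) → ∃ λ r → 12 < ∑ (λ i → sends (es i) (triangle P r))
    overloaded-triangle {j} j<t P none es = ∑-pigeonhole (λ r → ∑ (λ i → sends (es i) (triangle P r))) 12 (begin-strict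
      j * 12                                          ≡⟨ solve 1 (λ j → j :* con 12 := con 3 :* j :+ con 9 :* j) refl j ⟩
      3 * j + 9 * j                                   <⟨ +-monoˡ-< (9 * j) (*-monoʳ-< 3 j<t) ⟩
      3 * t + 9 * j                                   ≡⟨ solve 2 (λ t j → con 3 :* t :+ con 9 :* j := con 3 :* (t :+ j :* con 3)) refl t j ⟩
      3 * (t + j * 3)                                 ≡⟨ ∑-const {3} (t + j * 3) ⟨
      ∑ {3} (λ _ → t + j * 3)                         ≤⟨ ∑-mono-≤ (λ i → free-edge-sends P none (es i)) ⟩
      ∑ (λ i → ∑ (λ r → sends (es i) (triangle P r))) ≡⟨ ∑-comm (λ i r → sends (es i) (triangle P r)) ⟩
      ∑ (λ r → ∑ (λ i → sends (es i) (triangle P r))) ∎)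
      where open ≤-Reasoning

    grow-by-exchange : ∀ {j} → j < t → (P : Packing j) → ¬ (∃ λ x → ∃ λ y → ∃ λ z → FreeTriangle P x y z) → Packing (suc j)
    grow-by-exchange {zero} _ P none = ⊥-elim (<⇒≱ t≥1 (≤-trans (m≤m+n t 0) (free-edge-sends P none e)))
      where
      D≥1 : 1 ≤ D
      D≥1 = n≢0⇒n>0 λ D≡0 → <⇒≢ (≤-trans t≥1 (m≤n+m t N)) (trans (sym (cong₂ _+_ D≡0 D≡0)) degree-sum)
      e = proj₁ (free-edge-avoiding P [] (λ v → ≤-trans D≥1 (free-degree P v)))
    grow-by-exchange {j@(suc _)} j<t P none =
      let es , disjoint = three-disjoint-free-edges P (free-room (s≤s z≤n) j<t P)
          r , overloaded = overloaded-triangle j<t P none es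
          i , i′ , i≢i′ , heavy , heavy′ = two-heavy (λ i → sends (es i) (triangle P r)) (λ i → sends≤6 (es i) (triangle P r)) overloaded
      in exchange-along P r (es i) (es i′) (disjoint i i′ i≢i′) heavy heavy′

    grow : ∀ {j} → j < t → Packing j → Packing (suc j)
    grow j<t P with free-triangle? P
    ... | yes (x , y , z , (xy , xz , yz) , (fx , fy , fz)) = add-triangle P ⟨ x , y , z ⟩ (⟨⟩-isTriangle xy xz yz) free-τ
      where
      free-τ : ∀ s → free P (⟨ x , y , z ⟩ s) ≡ true
      free-τ zero = fx
      free-τ (suc zero) = fy
      free-τ (suc (suc zero)) = fz
    ... | no none = grow-by-exchange j<t P none

    packing : ∀ j → j ≤ t → Packing j
    packing zero _ = empty-packing
    packing (suc j) j<t = grow j<t (packing j (<⇒≤ j<t))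

  IsBookEmbedding : ∀ m → (Fin (2 + m) → Fin N) → Set
  IsBookEmbedding m h = (∀ u v → h u ≡ h v → u ≡ v) × (∀ u v → u ≢ v → toℕ u < 2 ⊎ toℕ v < 2 → A (h u) (h v) ≡ true)

  spine-pages : ∀ {m} → Fin N → Fin N → (Fin m → Fin N) → Fin (2 + m) → Fin N
  spine-pages p q pg zero = p
  spine-pages p q pg (suc zero) = q
  spine-pages p q pg (suc (suc i)) = pg i

  spine-pages-isBook : ∀ {m p q} (pg : Fin m → Fin N) → A p q ≡ true → (∀ i j → pg i ≡ pg j → i ≡ j) →
    (∀ i → A p (pg i) ≡ true) → (∀ i → A q (pg i) ≡ true) → IsBookEmbedding m (spine-pages p q pg)
  spine-pages-isBook {m} {p} {q} pg pq pg-inj p-pg q-pg = injective , edges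
    where
    injective : ∀ u v → spine-pages p q pg u ≡ spine-pages p q pg v → u ≡ v
    injective zero zero _ = refl
    injective zero (suc zero) e = ⊥-elim (adjacent⇒≢ pq e)
    injective zero (suc (suc j)) e = ⊥-elim (adjacent⇒≢ (p-pg j) e)
    injective (suc zero) zero e = ⊥-elim (adjacent⇒≢ pq (sym e))
    injective (suc zero) (suc zero) _ = refl
    injective (suc zero) (suc (suc j)) e = ⊥-elim (adjacent⇒≢ (q-pg j) e)
    injective (suc (suc i)) zero e = ⊥-elim (adjacent⇒≢ (p-pg i) (sym e))
    injective (suc (suc i)) (suc zero) e = ⊥-elim (adjacent⇒≢ (q-pg i) (sym e))
    injective (suc (suc i)) (suc (suc j)) e = cong (λ i → Fin.suc (Fin.suc i)) (pg-inj i j e)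
    from-spine : ∀ u v → toℕ u < 2 → u ≢ v → A (spine-pages p q pg u) (spine-pages p q pg v) ≡ true
    from-spine zero zero _ u≢u = ⊥-elim (u≢u refl)
    from-spine zero (suc zero) _ _ = pq
    from-spine zero (suc (suc j)) _ _ = p-pg j
    from-spine (suc zero) zero _ _ = adjacent-sym pq
    from-spine (suc zero) (suc zero) _ u≢u = ⊥-elim (u≢u refl)
    from-spine (suc zero) (suc (suc j)) _ _ = q-pg j
    from-spine (suc (suc i)) v (s≤s (s≤s ())) _
    edges : ∀ u v → u ≢ v → toℕ u < 2 ⊎ toℕ v < 2 → A (spine-pages p q pg u) (spine-pages p q pg v) ≡ true
    edges u v u≢v (inj₁ u<2) = from-spine u v u<2 u≢v
    edges u v u≢v (inj₂ v<2) = adjacent-sym (from-spine v u v<2 (≢-sym u≢v))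

  module BookExtension (D k Fb : ℕ) (min-degree : ∀ v → D ≤ count (A v))
    (room : 2 * Fb + 3 * k + N < 3 * D) where

    outside-degree : ∀ (T : Fin N → Bool) v → T v ≡ true → D + 1 ≤ count T + count (λ w → not (T w) ∧ A v w)
    outside-degree T v Tv = begin
      D + 1                                                   ≤⟨ +-monoˡ-≤ 1 (min-degree v) ⟩
      count (A v) + 1                                         ≡⟨ cong (_+ 1) (count-split T (A v)) ⟩
      (count (λ w → T w ∧ A v w) + outside) + 1               ≡⟨ solve 2 (λ a b → (a :+ b) :+ con 1 := (con 1 :+ a) :+ b) refl _ outside ⟩
      suc (count (λ w → T w ∧ A v w)) + outside               ≤⟨ +-monoˡ-≤ outside inside ⟩
      count T + outside                                       ∎
      where
      open ≤-Reasoning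
      outside = count (λ w → not (T w) ∧ A v w)
      inside : suc (count (λ w → T w ∧ A v w)) ≤ count T
      inside = begin
        suc (count (λ w → T w ∧ A v w)) ≤⟨ s≤s (count-mono _ (T ─ v) (λ w Tw∧vw →
                                              ─-intro T (∧-conicalˡ _ _ Tw∧vw) (≢-sym (adjacent⇒≢ (∧-conicalʳ _ _ Tw∧vw))))) ⟩
        suc (count (T ─ v))             ≡⟨ cong (λ b → 𝟙 b + count (T ─ v)) Tv ⟨
        𝟙 (T v) + count (T ─ v)         ≡⟨ count-─ T v ⟨
        count T                         ∎

    common-outside : (Fin N → Bool) → Fin N → Fin N → Fin N → Bool
    common-outside T p q w = not (T w) ∧ (A p w ∧ A q w)

    -- A vertex outside T adjacent to i ≤ 3 of a, b, c lies in at least i − 1 common neighbourhoods.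
    outside-degrees : ∀ (T : Fin N → Bool) a b c →
      count (λ w → not (T w) ∧ A a w) + (count (λ w → not (T w) ∧ A b w) + count (λ w → not (T w) ∧ A c w))
        ≤ (count (common-outside T a b) + (count (common-outside T b c) + count (common-outside T a c))) + count (not ∘ T)
    outside-degrees T a b c = begin
      count (R∧ a) + (count (R∧ b) + count (R∧ c))
        ≡⟨ ∑-+₃ (𝟙 ∘ R∧ a) (𝟙 ∘ R∧ b) (𝟙 ∘ R∧ c) ⟨
      ∑ (λ w → 𝟙 (R∧ a w) + (𝟙 (R∧ b w) + 𝟙 (R∧ c w)))
        ≤⟨ ∑-mono-≤ (λ w → 𝟙-three (not (T w)) (A a w) (A b w) (A c w)) ⟩
      ∑ (λ w → (𝟙 (common-outside T a b w) + (𝟙 (common-outside T b c w) + 𝟙 (common-outside T a c w))) + 𝟙 (not (T w)))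
        ≡⟨ ∑-+ _ (𝟙 ∘ not ∘ T) ⟩
      ∑ (λ w → 𝟙 (common-outside T a b w) + (𝟙 (common-outside T b c w) + 𝟙 (common-outside T a c w))) + count (not ∘ T)
        ≡⟨ cong (_+ count (not ∘ T)) (∑-+₃ (𝟙 ∘ common-outside T a b) (𝟙 ∘ common-outside T b c) (𝟙 ∘ common-outside T a c)) ⟩
      (count (common-outside T a b) + (count (common-outside T b c) + count (common-outside T a c))) + count (not ∘ T) ∎
      where
      open ≤-Reasoning
      R∧ : Fin N → Fin N → Bool
      R∧ v w = not (T w) ∧ A v w
      𝟙-three : ∀ r a b c → 𝟙 (r ∧ a) + (𝟙 (r ∧ b) + 𝟙 (r ∧ c)) ≤ (𝟙 (r ∧ (a ∧ b)) + (𝟙 (r ∧ (b ∧ c)) + 𝟙 (r ∧ (a ∧ c)))) + 𝟙 r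
      𝟙-three false a b c = z≤n
      𝟙-three true true true true = s≤s (s≤s (s≤s z≤n))
      𝟙-three true true true false = s≤s (s≤s z≤n)
      𝟙-three true true false true = s≤s (s≤s z≤n)
      𝟙-three true true false false = s≤s z≤n
      𝟙-three true false true true = s≤s (s≤s z≤n)
      𝟙-three true false true false = s≤s z≤n
      𝟙-three true false false true = s≤s z≤n
      𝟙-three true false false false = z≤n

    no-room-for-small-books : ∀ {cT cR r₀ r₁ r₂ c₀₁ c₁₂ c₀₂} →
      D + 1 ≤ cT + r₀ → D + 1 ≤ cT + r₁ → D + 1 ≤ cT + r₂ → r₀ + (r₁ + r₂) ≤ (c₀₁ + (c₁₂ + c₀₂)) + cR →
      cT + cR ≡ N → cT ≤ 3 + Fb → c₀₁ < k → c₁₂ < k → c₀₂ < k → ⊥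
    no-room-for-small-books {cT} {cR} {r₀} {r₁} {r₂} {c₀₁} {c₁₂} {c₀₂} h₀ h₁ h₂ hr hN hT k₀ k₁ k₂ =
      <⇒≱ room (+-cancelʳ-≤ 6 _ _ (begin
        3 * D + 6
          ≡⟨ solve 1 (λ D → con 3 :* D :+ con 6 := ((D :+ con 1) :+ ((D :+ con 1) :+ (D :+ con 1))) :+ con 3) refl D ⟩
        ((D + 1) + ((D + 1) + (D + 1))) + 3
          ≤⟨ +-monoˡ-≤ 3 (+-mono-≤ h₀ (+-mono-≤ h₁ h₂)) ⟩
        ((cT + r₀) + ((cT + r₁) + (cT + r₂))) + 3
          ≡⟨ solve 4 (λ cT a b c → ((cT :+ a) :+ ((cT :+ b) :+ (cT :+ c))) :+ con 3
                                  := (cT :+ cT) :+ ((cT :+ (a :+ (b :+ c))) :+ con 3)) refl cT r₀ r₁ r₂ ⟩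
        (cT + cT) + ((cT + (r₀ + (r₁ + r₂))) + 3)
          ≤⟨ +-monoʳ-≤ (cT + cT) (+-monoˡ-≤ 3 (+-monoʳ-≤ cT hr)) ⟩
        (cT + cT) + ((cT + ((c₀₁ + (c₁₂ + c₀₂)) + cR)) + 3)
          ≡⟨ cong ((cT + cT) +_) (solve 5 (λ cT cR a b c → (cT :+ ((a :+ (b :+ c)) :+ cR)) :+ con 3
                                                          := (cT :+ cR) :+ ((con 1 :+ a) :+ ((con 1 :+ b) :+ (con 1 :+ c))))
                                                   refl cT cR c₀₁ c₁₂ c₀₂) ⟩
        (cT + cT) + ((cT + cR) + (suc c₀₁ + (suc c₁₂ + suc c₀₂)))
          ≤⟨ +-mono-≤ (+-mono-≤ hT hT) (+-mono-≤ (≤-reflexive hN) (+-mono-≤ k₀ (+-mono-≤ k₁ k₂))) ⟩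
        ((3 + Fb) + (3 + Fb)) + (N + (k + (k + k)))
          ≡⟨ solve 3 (λ Fb k N → ((con 3 :+ Fb) :+ (con 3 :+ Fb)) :+ (N :+ (k :+ (k :+ k)))
                                := (con 2 :* Fb :+ con 3 :* k :+ N) :+ con 6) refl Fb k N ⟩
        (2 * Fb + 3 * k + N) + 6 ∎))
      where open ≤-Reasoning

    taken : Triangle → (Fin N → Bool) → Fin N → Bool
    taken τ F w = (w ∈ᵇ τ) ∨ F w

    not-taken : ∀ τ F {w} → not (taken τ F w) ≡ true → (∀ s → w ≢ τ s) × F w ≡ false
    not-taken τ F {w} h with w ∈ᵇ τ in w∉τ | F w
    ... | false | false = ∉ᵇ⇒≢ τ w∉τ , refl

    AvoidingBook : (Fin N → Bool) → Set
    AvoidingBook F = Σ (Fin (3 + k) → Fin N) λ h → IsBookEmbedding (suc k) h × (∀ u → F (h u) ≡ false)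

    book-over-edge : ∀ τ → IsTriangle τ → ∀ F → (∀ s → F (τ s) ≡ false) → ∀ {sp sq sr} → sp ≢ sq → sp ≢ sr → sq ≢ sr →
      k ≤ count (common-outside (taken τ F) (τ sp) (τ sq)) → AvoidingBook F
    book-over-edge τ isT F F-τ {sp} {sq} {sr} pq pr qr enough
      with pick-distinct k (common-outside (taken τ F) (τ sp) (τ sq)) enough
    ... | g , g-inj , g-common =
      spine-pages (τ sp) (τ sq) pages , spine-pages-isBook pages (isT sp sq pq) pages-inj p-pages q-pages , avoids
      where
      g-outside : ∀ i → (∀ s → g i ≢ τ s) × F (g i) ≡ false
      g-outside i = not-taken τ F (∧-conicalˡ (not (taken τ F (g i))) _ (g-common i))
      g-adjacent : ∀ i → A (τ sp) (g i) ∧ A (τ sq) (g i) ≡ true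
      g-adjacent i = ∧-conicalʳ (not (taken τ F (g i))) _ (g-common i)
      pages : Fin (suc k) → Fin N
      pages zero = τ sr
      pages (suc i) = g i
      pages-inj : ∀ i j → pages i ≡ pages j → i ≡ j
      pages-inj zero zero _ = refl
      pages-inj zero (suc j) e = ⊥-elim (proj₁ (g-outside j) sr (sym e))
      pages-inj (suc i) zero e = ⊥-elim (proj₁ (g-outside i) sr e)
      pages-inj (suc i) (suc j) e = cong suc (g-inj i j e)
      p-pages : ∀ i → A (τ sp) (pages i) ≡ true
      p-pages zero = isT sp sr pr
      p-pages (suc i) = ∧-conicalˡ (A (τ sp) (g i)) _ (g-adjacent i)
      q-pages : ∀ i → A (τ sq) (pages i) ≡ true
      q-pages zero = isT sq sr qr
      q-pages (suc i) = ∧-conicalʳ (A (τ sp) (g i)) _ (g-adjacent i)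
      avoids : ∀ u → F (spine-pages (τ sp) (τ sq) pages u) ≡ false
      avoids zero = F-τ sp
      avoids (suc zero) = F-τ sq
      avoids (suc (suc zero)) = F-τ sr
      avoids (suc (suc (suc i))) = proj₂ (g-outside i)

    extend-to-book : ∀ τ → IsTriangle τ → ∀ F → (∀ s → F (τ s) ≡ false) → count F ≤ Fb → AvoidingBook F
    extend-to-book τ isT F F-τ F≤Fb = choose (k ≤? c₀₁) (k ≤? c₁₂) (k ≤? c₀₂)
      where
      T = taken τ F
      c₀₁ c₁₂ c₀₂ : ℕ
      c₀₁ = count (common-outside T (τ zero) (τ (suc zero)))
      c₁₂ = count (common-outside T (τ (suc zero)) (τ (suc (suc zero))))
      c₀₂ = count (common-outside T (τ zero) (τ (suc (suc zero))))
      degree : ∀ s → D + 1 ≤ count T + count (λ w → not (T w) ∧ A (τ s) w)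
      degree s = outside-degree T (τ s) (subst (λ b → b ∨ F (τ s) ≡ true) (sym (∈ᵇ-image τ s)) refl)
      choose : Dec (k ≤ c₀₁) → Dec (k ≤ c₁₂) → Dec (k ≤ c₀₂) → AvoidingBook F
      choose (yes enough) _ _ = book-over-edge τ isT F F-τ {zero} {suc zero} {suc (suc zero)} (λ ()) (λ ()) (λ ()) enough
      choose (no _) (yes enough) _ = book-over-edge τ isT F F-τ {suc zero} {suc (suc zero)} {zero} (λ ()) (λ ()) (λ ()) enough
      choose (no _) (no _) (yes enough) = book-over-edge τ isT F F-τ {zero} {suc (suc zero)} {suc zero} (λ ()) (λ ()) (λ ()) enough
      choose (no few₀₁) (no few₁₂) (no few₀₂) = ⊥-elim (no-room-for-small-books
        (degree zero) (degree (suc zero)) (degree (suc (suc zero)))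
        (outside-degrees T (τ zero) (τ (suc zero)) (τ (suc (suc zero))))
        (count-complement T)
        (≤-trans (count-∨-≤ (_∈ᵇ τ) F) (+-mono-≤ (count-image-≤ τ) F≤Fb))
        (≰⇒> few₀₁) (≰⇒> few₁₂) (≰⇒> few₀₂))

  drop-first : ∀ {j} → Packing (suc j) → Packing j
  drop-first P = record
    { triangle = triangle P ∘ suc ; isTriangle = isTriangle P ∘ suc
    ; block = pred ∘ block P ; block-triangle = λ r s → cong pred (block-triangle P (suc r) s) }

  module DisjointBooks (D k Fb : ℕ) (min-degree : ∀ v → D ≤ count (A v))
    (room : 2 * Fb + 3 * k + N < 3 * D) where

    open BookExtension D k Fb min-degree room

    L : ℕ
    L = 3 + k

    BooksAvoiding : ℕ → (Fin N → Bool) → Set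
    BooksAvoiding j F = Σ (Fin j → Fin L → Fin N) λ H →
      (∀ i → IsBookEmbedding (suc k) (H i)) × (∀ i i′ u u′ → H i u ≡ H i′ u′ → i ≡ i′) × (∀ i u → F (H i u) ≡ false)

    books-around : ∀ j (P : Packing j) (F : Fin N → Bool) → (∀ r s → F (triangle P r s) ≡ false) →
      count F + L * j ≤ Fb + L → BooksAvoiding j F
    books-around zero P F F-P budget = (λ ()) , (λ ()) , (λ ()) , (λ ())
    books-around (suc j) P F F-P budget = H , H-book , H-disjoint , H-avoids
      where
      rest = drop-first P
      τ = triangle P zero
      F₁ : Fin N → Bool
      F₁ w = F w ∨ covered rest w
      τ-uncovered : ∀ s → covered rest (τ s) ≡ false
      τ-uncovered s = ⋁-none _ λ r → ∉ᵇ-intro (triangle rest r) λ s′ e → 0≢1+n (triangles-disjoint P s s′ e)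
      F₁-τ : ∀ s → F₁ (τ s) ≡ false
      F₁-τ s rewrite F-P zero s | τ-uncovered s = refl
      F₁≤Fb : count F₁ ≤ Fb
      F₁≤Fb = begin
        count F₁                       ≤⟨ count-∨-≤ F (covered rest) ⟩
        count F + count (covered rest) ≡⟨ cong (count F +_) (trans (count-covered rest) (*-comm j 3)) ⟩
        count F + 3 * j                ≤⟨ +-monoʳ-≤ (count F) (*-monoˡ-≤ j (m≤m+n 3 k)) ⟩
        count F + L * j                ≤⟨ +-cancelʳ-≤ L _ _ (≤-trans (≤-reflexive (solve 3 (λ c L j → (c :+ L :* j) :+ L := c :+ L :* (con 1 :+ j)) refl (count F) L j)) budget) ⟩
        Fb                             ∎
        where open ≤-Reasoning
      first = extend-to-book τ (isTriangle P zero) F₁ F₁-τ F₁≤Fb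
      h = proj₁ first
      h-avoids : ∀ u → F₁ (h u) ≡ false
      h-avoids = proj₂ (proj₂ first)
      F₂ : Fin N → Bool
      F₂ w = F w ∨ (w ∈ᵇ h)
      F₂-rest : ∀ r s → F₂ (triangle rest r s) ≡ false
      F₂-rest r s rewrite F-P (suc r) s = ∉ᵇ-intro h λ u e →
        free≢triangle rest r s (cong not (∨-conicalʳ _ _ (h-avoids u))) (sym e)
      F₂-budget : count F₂ + L * j ≤ Fb + L
      F₂-budget = ≤-trans (+-monoˡ-≤ (L * j) (≤-trans (count-∨-≤ F (_∈ᵇ h)) (+-monoʳ-≤ (count F) (count-image-≤ h))))
                          (≤-trans (≤-reflexive (solve 3 (λ c L j → (c :+ L) :+ L :* j := c :+ L :* (con 1 :+ j)) refl (count F) L j)) budget)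
      others = books-around j rest F₂ F₂-rest F₂-budget
      H : Fin (suc j) → Fin L → Fin N
      H zero = h
      H (suc i) = proj₁ others i
      H-book : ∀ i → IsBookEmbedding (suc k) (H i)
      H-book zero = proj₁ (proj₂ first)
      H-book (suc i) = proj₁ (proj₂ others) i
      others-avoid : ∀ i u → F₂ (proj₁ others i u) ≡ false
      others-avoid = proj₂ (proj₂ (proj₂ others))
      others≢h : ∀ i u u′ → proj₁ others i u ≢ h u′
      others≢h i u u′ e = ∉ᵇ⇒≢ h (∨-conicalʳ (F (proj₁ others i u)) _ (others-avoid i u)) u′ e
      H-disjoint : ∀ i i′ u u′ → H i u ≡ H i′ u′ → i ≡ i′
      H-disjoint zero zero u u′ e = refl
      H-disjoint zero (suc i′) u u′ e = ⊥-elim (others≢h i′ u′ u (sym e))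
      H-disjoint (suc i) zero u u′ e = ⊥-elim (others≢h i u u′ e)
      H-disjoint (suc i) (suc i′) u u′ e = cong suc (proj₁ (proj₂ (proj₂ others)) i i′ u u′ e)
      H-avoids : ∀ i u → F (H i u) ≡ false
      H-avoids zero u = ∨-conicalˡ _ _ (h-avoids u)
      H-avoids (suc i) u = ∨-conicalˡ _ _ (others-avoid i u)

-- The upper bound

isBlue : Colour → Bool
isBlue blue = true
isBlue red = false

≡ᵇ-sym : ∀ {n} (x y : Fin n) → (x ≡ᵇ y) ≡ (y ≡ᵇ x)
≡ᵇ-sym x y with x ≟ y | y ≟ x
... | yes _ | yes _ = refl
... | no _ | no _ = refl
... | yes x≡y | no y≢x = ⊥-elim (y≢x (sym x≡y))
... | no x≢y | yes y≡x = ⊥-elim (x≢y (sym y≡x))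

module ColourClasses {N : ℕ} (c : Colouring N) where

  others : Fin N → Fin N → Bool
  others x = (λ _ → true) ─ x

  blue-adj red-adj : Fin N → Fin N → Bool
  blue-adj x w = isBlue (col c x w) ∧ others x w
  red-adj x w = not (isBlue (col c x w)) ∧ others x w

  blue-sym : ∀ x y → blue-adj x y ≡ blue-adj y x
  blue-sym x y = cong₂ (λ χ b → isBlue χ ∧ (not b ∧ true)) (col-sym c x y) (≡ᵇ-sym y x)

  blue-irrefl : ∀ x → blue-adj x x ≡ false
  blue-irrefl x rewrite ≡ᵇ-refl x = ∧-zeroʳ _

  degrees : ∀ x → suc (count (blue-adj x) + count (red-adj x)) ≡ N
  degrees x = begin
    suc (count (blue-adj x) + count (red-adj x)) ≡⟨ cong suc (count-split (isBlue ∘ col c x) (others x)) ⟨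
    suc (count (others x))                       ≡⟨ count-─ (λ _ → true) x ⟨
    count {N} (λ _ → true)                       ≡⟨ count-const-true ⟩
    N                                            ∎
    where open ≡-Reasoning

  few-red⇒many-blue : ∀ {m} x → count (red-adj x) < m → N ≤ count (blue-adj x) + m
  few-red⇒many-blue x few = begin
    N                                               ≡⟨ degrees x ⟨
    suc (count (blue-adj x) + count (red-adj x))    ≡⟨ +-suc _ _ ⟨
    count (blue-adj x) + suc (count (red-adj x))    ≤⟨ +-monoʳ-≤ _ few ⟩
    count (blue-adj x) + _                          ∎
    where open ≤-Reasoning

  red-star : ∀ {m} x → m ≤ count (red-adj x) → HasMonoCopy (Star (suc m)) red c
  red-star {m} x many with pick-distinct m (red-adj x) many
  ... | g , g-inj , g-red = f , (λ {u} {v} → f-inj u v) , edges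
    where
    f : Fin (suc m) → Fin N
    f zero = x
    f (suc i) = g i
    x≢g : ∀ i → x ≢ g i
    x≢g i = ≢-sym (─-≢ (λ _ → true) (∧-conicalʳ (not (isBlue (col c x (g i)))) _ (g-red i)))
    col-red : ∀ i → col c x (g i) ≡ red
    col-red i with col c x (g i) | g-red i
    ... | red | _ = refl
    f-inj : ∀ u v → f u ≡ f v → u ≡ v
    f-inj zero zero _ = refl
    f-inj zero (suc j) e = ⊥-elim (x≢g j e)
    f-inj (suc i) zero e = ⊥-elim (x≢g i (sym e))
    f-inj (suc i) (suc j) e = cong suc (g-inj i j e)
    edges : ∀ u v → Adj (Star (suc m)) u v → col c (f u) (f v) ≡ red
    edges zero (suc i) _ = col-red i
    edges (suc i) zero _ = trans (col-sym c (g i) x) (col-red i)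
    edges zero zero (inj₁ (_ , 0≢0)) = ⊥-elim (0≢0 refl)
    edges zero zero (inj₂ (_ , 0≢0)) = ⊥-elim (0≢0 refl)
    edges (suc i) (suc j) (inj₁ (() , _))
    edges (suc i) (suc j) (inj₂ (() , _))

  open SimpleGraph blue-adj blue-sym blue-irrefl using (IsBookEmbedding)

  blue-books : ∀ {t k} (H : Fin t → Fin (3 + k) → Fin N) → (∀ i → IsBookEmbedding (suc k) (H i)) →
    (∀ i i′ u u′ → H i u ≡ H i′ u′ → i ≡ i′) → HasMonoCopy (Copies t (Book (suc k))) blue c
  blue-books {t} {k} H H-book H-disjoint = f , (λ {p} {q} → f-inj p q) , edges
    where
    relabel : Fin (suc k + 2) → Fin (3 + k)
    relabel = cast (cong suc (+-comm k 2))
    relabel-inj : ∀ u v → relabel u ≡ relabel v → u ≡ v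
    relabel-inj u v e = toℕ-injective (trans (sym (toℕ-cast _ u)) (trans (cong toℕ e) (toℕ-cast _ v)))
    f : Fin t × Fin (suc k + 2) → Fin N
    f (i , u) = H i (relabel u)
    f-inj : ∀ p q → f p ≡ f q → p ≡ q
    f-inj (i , u) (i′ , v) e with H-disjoint i i′ _ _ e
    ... | refl = cong (i ,_) (relabel-inj u v (proj₁ (H-book i) _ _ e))
    isBlue⇒blue : ∀ {χ} → isBlue χ ≡ true → χ ≡ blue
    isBlue⇒blue {blue} _ = refl
    edges : ∀ p q → Adj (Copies t (Book (suc k))) p q → col c (f p) (f q) ≡ blue
    edges (i , u) (.i , v) (refl , u≢v , spine) = isBlue⇒blue (∧-conicalˡ _ _
      (proj₂ (H-book i) (relabel u) (relabel v) (u≢v ∘ relabel-inj u v)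
             (Sum.map (subst (_< 2) (sym (toℕ-cast _ u))) (subst (_< 2) (sym (toℕ-cast _ v))) spine)))

large-degree-bound : ∀ m t′ k′ → 3 * (t′ * k′) + 6 * t′ + 3 * k′ ≤ m → 2 ≤ suc t′ → 3 * suc t′ + 2 ≤ suc (m + t′)
large-degree-bound m t′ k′ large (s≤s t′≥1) = begin
  3 * suc t′ + 2              ≡⟨ solve 1 (λ t → con 3 :* (con 1 :+ t) :+ con 2 := con 1 :+ ((con 2 :* t :+ con 4) :+ t)) refl t′ ⟩
  suc ((2 * t′ + 4) + t′)     ≤⟨ s≤s (+-monoˡ-≤ t′ (≤-trans (+-monoʳ-≤ (2 * t′) (*-monoʳ-≤ 4 t′≥1)) six-t′≤m)) ⟩
  suc (m + t′)                ∎
  where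
  open ≤-Reasoning
  six-t′≤m : 2 * t′ + 4 * t′ ≤ m
  six-t′≤m = begin
    2 * t′ + 4 * t′                         ≡⟨ solve 1 (λ t → con 2 :* t :+ con 4 :* t := con 6 :* t) refl t′ ⟩
    6 * t′                                  ≤⟨ m≤n+m (6 * t′) (3 * (t′ * k′)) ⟩
    3 * (t′ * k′) + 6 * t′                  ≤⟨ m≤m+n _ (3 * k′) ⟩
    3 * (t′ * k′) + 6 * t′ + 3 * k′         ≤⟨ large ⟩
    m                                       ∎

room-bound : ∀ m t′ k′ → 3 * (t′ * k′) + 6 * t′ + 3 * k′ ≤ m →
  2 * ((3 + k′) * t′) + 3 * k′ + suc (m + m + t′) < 3 * suc (m + t′)
room-bound m t′ k′ large = begin-strict
  2 * ((3 + k′) * t′) + 3 * k′ + suc (m + m + t′)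
    ≡⟨ solve 3 (λ m t k → con 2 :* ((con 3 :+ k) :* t) :+ con 3 :* k :+ (con 1 :+ (m :+ m :+ t))
                       := (con 2 :* (t :* k) :+ con 4 :* t :+ con 3 :* k) :+ (con 1 :+ (con 2 :* m :+ con 3 :* t))) refl m t′ k′ ⟩
  (2 * (t′ * k′) + 4 * t′ + 3 * k′) + suc (2 * m + 3 * t′)
    <⟨ +-monoˡ-< _ (s≤s (≤-trans (+-monoˡ-≤ (3 * k′) (+-mono-≤ (*-monoˡ-≤ (t′ * k′) (n≤1+n 2)) (*-monoˡ-≤ t′ (m≤m+n 4 2)))) large)) ⟩
  suc m + suc (2 * m + 3 * t′)
    <⟨ n<1+n _ ⟩
  suc (suc m + suc (2 * m + 3 * t′))
    ≡⟨ solve 2 (λ m t → con 1 :+ ((con 1 :+ m) :+ (con 1 :+ (con 2 :* m :+ con 3 :* t))) := con 3 :* (con 1 :+ (m :+ t))) refl m t′ ⟩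
  3 * suc (m + t′) ∎
  where open ≤-Reasoning

open ColourClasses using (red-adj; red-star)

blue-books-if-few-red : ∀ m t′ k′ → 3 * (t′ * k′) + 6 * t′ + 3 * k′ ≤ m → (c : Colouring (suc (m + m + t′))) →
  (∀ x → count (red-adj c x) < m) → HasMonoCopy (Copies (suc t′) (Book (suc k′))) blue c
blue-books-if-few-red m t′ k′ large c few = blue-books (proj₁ books) (proj₁ (proj₂ books)) (proj₁ (proj₂ (proj₂ books)))
  where
  open ColourClasses c
  N t D : ℕ
  N = suc (m + m + t′)
  t = suc t′
  D = suc (m + t′)
  min-degree : ∀ v → D ≤ count (blue-adj v)
  min-degree v = +-cancelʳ-≤ m _ _ (subst (_≤ count (blue-adj v) + m)
    (solve 2 (λ m t → con 1 :+ (m :+ m :+ t) := (con 1 :+ (m :+ t)) :+ m) refl m t′)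
    (few-red⇒many-blue v (few v)))
  degree-sum : D + D ≡ N + t
  degree-sum = solve 2 (λ m t → (con 1 :+ (m :+ t)) :+ (con 1 :+ (m :+ t)) := (con 1 :+ (m :+ m :+ t)) :+ (con 1 :+ t)) refl m t′
  open SimpleGraph blue-adj blue-sym blue-irrefl hiding (IsBookEmbedding)
  open Growth D t min-degree degree-sum (s≤s z≤n) (large-degree-bound m t′ k′ large) zero
  open DisjointBooks D k′ ((3 + k′) * t′) min-degree (room-bound m t′ k′ large)
  budget : count {N} (λ _ → false) + L * t ≤ (3 + k′) * t′ + L
  budget = ≤-reflexive (trans (cong (_+ L * t) (count-const-false {N})) (trans (*-suc L t′) (+-comm L _)))
  books = books-around t (packing t ≤-refl) (λ _ → false) (λ _ _ → refl) budget

upper-bound : ∀ m t′ k′ → 3 * (t′ * k′) + 6 * t′ + 3 * k′ ≤ m →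
  Arrows (suc (m + m + t′)) (Star (suc m)) (Copies (suc t′) (Book (suc k′)))
upper-bound m t′ k′ large c with any? (λ x → m ≤? count (red-adj c x))
... | yes (x , many) = inj₁ (red-star c x many)
... | no few = inj₂ (blue-books-if-few-red m t′ k′ large c λ x → ≰⇒> λ many → few (x , many))

-- The lower bound

book-triangle : ∀ k → Σ (Fin 3 → Fin (suc k + 2)) λ corner → ∀ s s′ → s ≢ s′ → Adj (Book (suc k)) (corner s) (corner s′)
book-triangle k = corner , corner-adj
  where
  corner : Fin 3 → Fin (suc k + 2)
  corner s = fromℕ< (s≤s (≤-trans (≤-pred (toℕ<n s)) (m≤n+m 2 k)))
  toℕ-corner : ∀ s → toℕ (corner s) ≡ toℕ s
  toℕ-corner s = toℕ-fromℕ< _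
  spine : ∀ s s′ → s ≢ s′ → toℕ s < 2 ⊎ toℕ s′ < 2
  spine zero _ _ = inj₁ (s≤s z≤n)
  spine (suc zero) _ _ = inj₁ (s≤s (s≤s z≤n))
  spine (suc (suc zero)) zero _ = inj₂ (s≤s z≤n)
  spine (suc (suc zero)) (suc zero) _ = inj₂ (s≤s (s≤s z≤n))
  spine (suc (suc zero)) (suc (suc zero)) s≢s = ⊥-elim (s≢s refl)
  corner-adj : ∀ s s′ → s ≢ s′ → Adj (Book (suc k)) (corner s) (corner s′)
  corner-adj s s′ s≢s′ =
    (λ e → s≢s′ (toℕ-injective (trans (sym (toℕ-corner s)) (trans (cong toℕ e) (toℕ-corner s′))))) ,
    Sum.map (subst (_< 2) (sym (toℕ-corner s))) (subst (_< 2) (sym (toℕ-corner s′))) (spine s s′ s≢s′)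

-- Blue is K_{t−1} joined to the complete bipartite graph between two red cliques of size m;
-- hub vertices are those of the K_{t−1}.
module ExtremalColouring {N : ℕ} (t′ m₁ : ℕ) (N≤ : N ≤ t′ + (suc m₁ + suc m₁)) where

  m = suc m₁

  Kind : Set
  Kind = Fin t′ ⊎ (Fin m ⊎ Fin m)

  kind : Fin N → Kind
  kind v = Sum.map₂ (splitAt m) (splitAt t′ (inject≤ v N≤))

  kind-injective : ∀ v w → kind v ≡ kind w → v ≡ w
  kind-injective v w e = inject≤-injective N≤ N≤ v w (splitAt-injective t′ _ _ (map₂-injective (splitAt-injective m) e))
    where
    splitAt-injective : ∀ a {b} (i j : Fin (a + b)) → splitAt a i ≡ splitAt a j → i ≡ j
    splitAt-injective a i j e = trans (sym (join-splitAt a _ i)) (trans (cong (join a _) e) (join-splitAt a _ j))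
    map₂-injective : ∀ {A B C : Set} {f : B → C} → (∀ x y → f x ≡ f y → x ≡ y) →
      ∀ {p q : A ⊎ B} → Sum.map₂ f p ≡ Sum.map₂ f q → p ≡ q
    map₂-injective f-inj {inj₁ a} {inj₁ .a} refl = refl
    map₂-injective f-inj {inj₂ b} {inj₂ b′} e = cong inj₂ (f-inj b b′ (inj₂-injective e))

  colourOf : Kind → Kind → Colour
  colourOf (inj₂ (inj₁ _)) (inj₂ (inj₁ _)) = red
  colourOf (inj₂ (inj₂ _)) (inj₂ (inj₂ _)) = red
  colourOf _ _ = blue

  colourOf-sym : ∀ a b → colourOf a b ≡ colourOf b a
  colourOf-sym (inj₁ _) (inj₁ _) = refl
  colourOf-sym (inj₁ _) (inj₂ (inj₁ _)) = refl
  colourOf-sym (inj₁ _) (inj₂ (inj₂ _)) = refl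
  colourOf-sym (inj₂ (inj₁ _)) (inj₁ _) = refl
  colourOf-sym (inj₂ (inj₂ _)) (inj₁ _) = refl
  colourOf-sym (inj₂ (inj₁ _)) (inj₂ (inj₁ _)) = refl
  colourOf-sym (inj₂ (inj₁ _)) (inj₂ (inj₂ _)) = refl
  colourOf-sym (inj₂ (inj₂ _)) (inj₂ (inj₁ _)) = refl
  colourOf-sym (inj₂ (inj₂ _)) (inj₂ (inj₂ _)) = refl

  colouring : Colouring N
  colouring = record { col = λ v w → colourOf (kind v) (kind w) ; sym = λ v w → colourOf-sym (kind v) (kind w) }

  index : Kind → Fin m
  index (inj₁ _) = zero
  index (inj₂ (inj₁ i)) = i
  index (inj₂ (inj₂ i)) = i

  red-loop : ∀ a b → colourOf a b ≡ red → colourOf a a ≡ red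
  red-loop (inj₂ (inj₁ _)) (inj₂ (inj₁ _)) _ = refl
  red-loop (inj₂ (inj₂ _)) (inj₂ (inj₂ _)) _ = refl

  same-clique : ∀ a b c → colourOf a b ≡ red → colourOf a c ≡ red → index b ≡ index c → b ≡ c
  same-clique (inj₂ (inj₁ _)) (inj₂ (inj₁ _)) (inj₂ (inj₁ _)) _ _ e = cong (inj₂ ∘ inj₁) e
  same-clique (inj₂ (inj₂ _)) (inj₂ (inj₂ _)) (inj₂ (inj₂ _)) _ _ e = cong (inj₂ ∘ inj₂) e

  no-red-star : ¬ HasMonoCopy (Star (suc m)) red colouring
  no-red-star (f , f-inj , red-edges) = distinct-indices (pigeonhole (n<1+n m) (index ∘ κ))
    where
    κ : Fin (suc m) → Kind
    κ = kind ∘ f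
    κ₀ = κ zero
    to-leaf : ∀ i → colourOf κ₀ (κ (suc i)) ≡ red
    to-leaf i = red-edges zero (suc i) (inj₁ (refl , λ ()))
    to-centre : ∀ u → colourOf κ₀ (κ u) ≡ red
    to-centre zero = red-loop κ₀ (κ (suc zero)) (to-leaf zero)
    to-centre (suc i) = to-leaf i
    distinct-indices : (∃₂ λ u v → u Fin.< v × index (κ u) ≡ index (κ v)) → ⊥
    distinct-indices (u , v , u<v , same) =
      <-irrefl (cong toℕ (f-inj (kind-injective _ _ (same-clique κ₀ (κ u) (κ v) (to-centre u) (to-centre v) same)))) u<v

  Hub : Kind → Set
  Hub a = ∃ λ h → a ≡ inj₁ h

  -- Two of three non-hub vertices lie in the same red clique.
  blue-triangle-hub : ∀ a b c → colourOf a b ≡ blue → colourOf a c ≡ blue → colourOf b c ≡ blue → Hub a ⊎ Hub b ⊎ Hub c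
  blue-triangle-hub (inj₁ h) _ _ _ _ _ = inj₁ (h , refl)
  blue-triangle-hub (inj₂ _) (inj₁ h) _ _ _ _ = inj₂ (inj₁ (h , refl))
  blue-triangle-hub (inj₂ _) (inj₂ _) (inj₁ h) _ _ _ = inj₂ (inj₂ (h , refl))
  blue-triangle-hub (inj₂ (inj₁ _)) (inj₂ (inj₁ _)) (inj₂ _) () _ _
  blue-triangle-hub (inj₂ (inj₂ _)) (inj₂ (inj₂ _)) (inj₂ _) () _ _
  blue-triangle-hub (inj₂ (inj₁ _)) (inj₂ (inj₂ _)) (inj₂ (inj₁ _)) _ () _
  blue-triangle-hub (inj₂ (inj₁ _)) (inj₂ (inj₂ _)) (inj₂ (inj₂ _)) _ _ ()
  blue-triangle-hub (inj₂ (inj₂ _)) (inj₂ (inj₁ _)) (inj₂ (inj₁ _)) _ _ ()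
  blue-triangle-hub (inj₂ (inj₂ _)) (inj₂ (inj₁ _)) (inj₂ (inj₂ _)) _ () _

  no-blue-books : ∀ k → ¬ HasMonoCopy (Copies (suc t′) (Book (suc k))) blue colouring
  no-blue-books k (f , f-inj , blue-edges) = distinct-hubs (pigeonhole (n<1+n t′) (proj₁ ∘ hub))
    where
    corner = proj₁ (book-triangle k)
    corner-adj = proj₂ (book-triangle k)
    κ : Fin (suc t′) → Fin 3 → Kind
    κ i s = kind (f (i , corner s))
    blue-edge : ∀ i s s′ → s ≢ s′ → colourOf (κ i s) (κ i s′) ≡ blue
    blue-edge i s s′ s≢s′ = blue-edges (i , corner s) (i , corner s′) (refl , corner-adj s s′ s≢s′)
    hub : ∀ i → Σ (Fin t′) λ h → Σ (Fin (suc k + 2)) λ u → kind (f (i , u)) ≡ inj₁ h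
    hub i with blue-triangle-hub (κ i zero) (κ i (suc zero)) (κ i (suc (suc zero)))
                 (blue-edge i zero (suc zero) (λ ())) (blue-edge i zero (suc (suc zero)) (λ ()))
                 (blue-edge i (suc zero) (suc (suc zero)) (λ ()))
    ... | inj₁ (h , e) = h , corner zero , e
    ... | inj₂ (inj₁ (h , e)) = h , corner (suc zero) , e
    ... | inj₂ (inj₂ (h , e)) = h , corner (suc (suc zero)) , e
    distinct-hubs : (∃₂ λ i i′ → i Fin.< i′ × proj₁ (hub i) ≡ proj₁ (hub i′)) → ⊥
    distinct-hubs (i , i′ , i<i′ , same) = <-irrefl (cong (toℕ ∘ proj₁) (f-inj (kind-injective _ _ same-vertex))) i<i′
      where
      same-vertex = trans (proj₂ (proj₂ (hub i))) (trans (cong inj₁ same) (sym (proj₂ (proj₂ (hub i′)))))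

lower-bound : ∀ {N} m₁ t′ k′ → N ≤ t′ + (suc m₁ + suc m₁) →
  ¬ Arrows N (Star (suc (suc m₁))) (Copies (suc t′) (Book (suc k′)))
lower-bound m₁ t′ k′ N≤ arrows = Sum.[ no-red-star , no-blue-books k′ ]′ (arrows colouring)
  where open ExtremalColouring t′ m₁ N≤

no-arrows-below : ∀ m t′ k′ → t′ ≤ m → ∀ N → 1 ≤ N → N < suc (m + m + t′) →
  ¬ Arrows N (Star (suc m)) (Copies (suc t′) (Book (suc k′)))
no-arrows-below zero t′ k′ t′≤0 N 1≤N N≤t′ _ = <⇒≱ 1≤N (≤-trans (≤-pred N≤t′) t′≤0)
no-arrows-below (suc m₁) t′ k′ _ N _ N≤ =
  lower-bound m₁ t′ k′ (≤-trans (≤-pred N≤) (≤-reflexive (+-comm (suc m₁ + suc m₁) t′)))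

order-bound : ∀ t′ k′ → 3 * suc t′ * suc k′ + 3 * suc t′ ∸ 5 ≡ suc (3 * (t′ * k′) + 6 * t′ + 3 * k′)
order-bound t′ k′ = begin
  3 * suc t′ * suc k′ + 3 * suc t′ ∸ 5       ≡⟨ cong (_∸ 5) (solve 2 (λ t k → con 3 :* (con 1 :+ t) :* (con 1 :+ k) :+ con 3 :* (con 1 :+ t)
                                                               := (con 3 :* (t :* k) :+ con 6 :* t :+ con 3 :* k) :+ con 6) refl t′ k′) ⟩
  (3 * (t′ * k′) + 6 * t′ + 3 * k′) + 6 ∸ 5  ≡⟨ +-∸-assoc (3 * (t′ * k′) + 6 * t′ + 3 * k′) {6} {5} (n≤1+n 5) ⟩
  (3 * (t′ * k′) + 6 * t′ + 3 * k′) + 1      ≡⟨ +-comm _ 1 ⟩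
  suc (3 * (t′ * k′) + 6 * t′ + 3 * k′)      ∎
  where open ≡-Reasoning

theorem1p9 : (k t n : ℕ) → 1 ≤ k → 1 ≤ t → 3 * t * k + 3 * t ∸ 5 ≤ n →
    IsRamseyNumber (Star n) (Copies t (Book k)) (2 * n + t ∸ 2)
theorem1p9 (suc k′) (suc t′) n _ _ large with ≤-trans (≤-reflexive (sym (order-bound t′ k′))) large
... | s≤s {n = m} X≤m =
  subst (IsRamseyNumber (Star (suc m)) (Copies (suc t′) (Book (suc k′)))) (sym value)
    (s≤s z≤n , upper-bound m t′ k′ X≤m , no-arrows-below m t′ k′ t′≤m)
  where
  value : 2 * suc m + suc t′ ∸ 2 ≡ suc (m + m + t′)
  value = cong (_∸ 2) (solve 2 (λ m t → con 2 :* (con 1 :+ m) :+ (con 1 :+ t) := con 2 :+ (con 1 :+ (m :+ m :+ t))) refl m t′)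
  t′≤m : t′ ≤ m
  t′≤m = ≤-trans (m≤m+n t′ (5 * t′)) (≤-trans (m≤n+m (6 * t′) (3 * (t′ * k′))) (≤-trans (m≤m+n _ (3 * k′)) X≤m))
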